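{- Let $n\ge 3$ and $m=n-2$. In the straight linear 2-tree on $n$ vertices, the maximum of the resistance distance $r_m(a,b)$ over all pairs of vertices $a,b$ is $r_m(1,n)$.
   Context: The straight linear 2-tree on $n$ vertices is the graph with vertex set $\{1,\dots,n\}$ in which $\{a,b\}$ is an edge iff $0<|a-b|\le 2$; every edge is a unit resistor, and $r_m(a,b)=(\mathbf e_a-\mathbf e_b)^TL^{\dagger}(\mathbf e_a-\mathbf e_b)$ with $L^\dagger$ the Moore–Penrose inverse of its Laplacian. -}

module Defs where

open import Data.Nat as ℕ using (ℕ; zero; suc; ∣_-_∣; _≤ᵇ_; _<ᵇ_)
open import Data.Fin using (Fin; zero; suc; toℕ; fromℕ)
open import Data.Bool using (Bool; true; false; if_then_else_; _∧_)
open import Data.Rational using (ℚ; 0ℚ; 1ℚ; _+_; _*_; -_; _-_)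
open import Relation.Binary.PropositionalEquality using (_≡_)
open import Data.Fin using (_≟_)
open import Relation.Nullary.Decidable using (⌊_⌋)

Matrix : ℕ → Set
Matrix n = Fin n → Fin n → ℚ

Σ : ∀ {n} → (Fin n → ℚ) → ℚ
Σ {zero}  f = 0ℚ
Σ {suc n} f = f zero + Σ (λ i → f (suc i))

_·_ : ∀ {n} → Matrix n → Matrix n → Matrix n
(A · B) i j = Σ (λ k → A i k * B k j)

transpose : ∀ {n} → Matrix n → Matrix n
transpose A i j = A j i

record IsMoorePenroseInverse {n} (A X : Matrix n) : Set where
  field
    p1 : ∀ i j → ((A · X) · A) i j ≡ A i j
    p2 : ∀ i j → ((X · A) · X) i j ≡ X i j
    p3 : ∀ i j → transpose (A · X) i j ≡ (A · X) i j
    p4 : ∀ i j → transpose (X · A) i j ≡ (X · A) i j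

-- Straight linear 2-tree on n vertices (vertex i+1 ↔ Fin index i):
-- {a,b} edge iff 0 < |a-b| ≤ 2
adjacentᵇ : ∀ {n} → Fin n → Fin n → Bool
adjacentᵇ a b = (0 <ᵇ ∣ toℕ a - toℕ b ∣) ∧ (∣ toℕ a - toℕ b ∣ ≤ᵇ 2)

adjacency : ∀ n → Matrix n
adjacency n a b = if adjacentᵇ a b then 1ℚ else 0ℚ

degree : ∀ n → Fin n → ℚ
degree n a = Σ (λ b → adjacency n a b)

laplacian : ∀ n → Matrix n
laplacian n a b = if ⌊ a ≟ b ⌋ then degree n a - adjacency n a b else - adjacency n a b

eDiff : ∀ {n} → Fin n → Fin n → Fin n → ℚ
eDiff a b i = (if ⌊ i ≟ a ⌋ then 1ℚ else 0ℚ) - (if ⌊ i ≟ b ⌋ then 1ℚ else 0ℚ)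

-- r(a,b) = (e_a - e_b)^T X (e_a - e_b), X = L†
resistance : ∀ {n} → Matrix n → Fin n → Fin n → ℚ
resistance X a b = Σ (λ i → Σ (λ j → eDiff a b i * X i j * eDiff a b j))

module Submission where

-- Write a potential x on the vertices through its gaps yᵢ = xᵢ − xᵢ₊₁. The energy form of the
-- 2-tree becomes Q_k(y, u) = Σ yᵢuᵢ + Σ (yᵢ + yᵢ₊₁)(uᵢ + uᵢ₊₁), and the Penrose conditions force
-- L X = I − αJ, so the gaps y of the potential X(e_a − e_b) satisfy Q_k(y, y) = r(a, b), which is
-- also the sum of the gaps between a and b. Restricting Q to the window of those m gaps can only
-- decrease it, and comparing y with the vector W_m representing the sum functional of Q_m
-- (explicit in Lucas numbers) gives r(a, b) ≤ Q_m(W_m, W_m) = endToEnd m. By the Dirichlet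
-- principle endToEnd m grows with m, and endToEnd k is r(1, n). When a and b are adjacent the
-- window has length 2 and the sum functional is replaced by a coordinate functional.

open import Defs
open import Data.Nat using (ℕ; suc; _≤_)
open import Data.Fin using (Fin; zero; fromℕ)
open import Data.Rational using (ℚ) renaming (_≤_ to _≤ℚ_)

open import Algebra.Bundles using (CommutativeRing)
open import Data.Bool using (true; false; if_then_else_; _∧_)
open import Data.Empty using (⊥-elim)
open import Data.Fin using (suc; toℕ; _≟_)
open import Data.Fin.Properties using (suc-injective; toℕ≤pred[n]; toℕ-fromℕ; toℕ-injective)
open import Data.Nat using (zero; _<_; _>_; z≤n; s≤s; _∸_; pred; ∣_-_∣; _<ᵇ_; _≤ᵇ_) renaming (_+_ to _+ℕ_)
import Data.Nat.Properties as ℕ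
open import Data.Rational using (0ℚ; 1ℚ; normalize; 1/_; NonZero; _+_; _*_; -_; _-_; nonNegative; nonPositive; negative; positive)
  renaming (_<_ to _<ℚ_)
import Data.Rational.Properties as ℚ
open import Data.Sum using (inj₁; inj₂)
open import Relation.Binary.Definitions using (Tri; tri<; tri≈; tri>)
open import Relation.Binary.PropositionalEquality
open import Relation.Nullary.Decidable using (Dec; ⌊_⌋; yes; no; toWitness)
open import Relation.Nullary.Decidable.Core using (dec⇒maybe)
open import Tactic.RingSolver using (solve-∀)
open import Tactic.RingSolver.Core.AlmostCommutativeRing using (AlmostCommutativeRing; fromCommutativeRing)

open import Algebra.Properties.Group ℚ.+-0-group using (x∙y⁻¹≈ε⇒x≈y)
open import Algebra.Properties.Semiring.Sum (CommutativeRing.semiring ℚ.+-*-commutativeRing)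
  using (sum; sum-cong-≋; sum-replicate-zero; ∑-distrib-+; ∑-comm; *-distribˡ-sum; *-distribʳ-sum)

ℚ-ring : AlmostCommutativeRing _ _
ℚ-ring = fromCommutativeRing ℚ.+-*-commutativeRing (λ x → dec⇒maybe (0ℚ ℚ.≟ x))

Σ≡sum : ∀ {n} (f : Fin n → ℚ) → Σ f ≡ sum f
Σ≡sum {zero}  f = refl
Σ≡sum {suc n} f = cong (f zero +_) (Σ≡sum (λ i → f (suc i)))

∑-distrib-- : ∀ {n} (f g : Fin n → ℚ) → sum (λ i → f i - g i) ≡ sum f - sum g
∑-distrib-- {zero}  f g = refl
∑-distrib-- {suc n} f g = trans (cong ((f zero - g zero) +_) (∑-distrib-- (λ i → f (suc i)) (λ i → g (suc i))))
  (interchange (f zero) (g zero) _ _)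
  where
  interchange : ∀ a b c d → (a - b) + (c - d) ≡ (a + c) - (b + d)
  interchange = solve-∀ ℚ-ring

δ : ∀ {n} → Fin n → Fin n → ℚ
δ i j = if ⌊ i ≟ j ⌋ then 1ℚ else 0ℚ

δ-sym : ∀ {n} (i j : Fin n) → δ i j ≡ δ j i
δ-sym i j with i ≟ j | j ≟ i
... | yes _   | yes _   = refl
... | no _    | no _    = refl
... | yes i≡j | no j≢i  = ⊥-elim (j≢i (sym i≡j))
... | no i≢j  | yes j≡i = ⊥-elim (i≢j (sym j≡i))

δ-suc : ∀ {n} (i j : Fin n) → δ (suc i) (suc j) ≡ δ i j
δ-suc i j with i ≟ j | suc i ≟ suc j
... | yes _   | yes _    = refl
... | no _    | no _     = refl
... | yes i≡j | no si≢sj = ⊥-elim (si≢sj (cong suc i≡j))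
... | no i≢j  | yes si≡sj = ⊥-elim (i≢j (suc-injective si≡sj))

sum-δ : ∀ {n} (a : Fin n) (f : Fin n → ℚ) → sum (λ j → δ j a * f j) ≡ f a
sum-δ {suc n} zero f = begin
  1ℚ * f zero + sum (λ j → 0ℚ * f (suc j))
    ≡⟨ cong (1ℚ * f zero +_) (trans (sum-cong-≋ (λ j → ℚ.*-zeroˡ (f (suc j)))) (sum-replicate-zero n)) ⟩
  1ℚ * f zero + 0ℚ
    ≡⟨ trans (ℚ.+-identityʳ _) (ℚ.*-identityˡ _) ⟩
  f zero ∎
  where open ≡-Reasoning
sum-δ {suc n} (suc a) f = begin
  0ℚ * f zero + sum (λ j → δ (suc j) (suc a) * f (suc j))
    ≡⟨ cong₂ _+_ (ℚ.*-zeroˡ (f zero)) (sum-cong-≋ (λ j → cong (_* f (suc j)) (δ-suc j a))) ⟩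
  0ℚ + sum (λ j → δ j a * f (suc j))
    ≡⟨ trans (ℚ.+-identityˡ _) (sum-δ a (λ j → f (suc j))) ⟩
  f (suc a) ∎
  where open ≡-Reasoning

sumℕ : ℕ → (ℕ → ℚ) → ℚ
sumℕ n f = sum {n} (λ i → f (toℕ i))

sumℕ-distrib-+ : ∀ n (f g : ℕ → ℚ) → sumℕ n (λ i → f i + g i) ≡ sumℕ n f + sumℕ n g
sumℕ-distrib-+ n f g = ∑-distrib-+ {n} (λ i → f (toℕ i)) (λ i → g (toℕ i))

sumℕ-cong< : ∀ n {f g : ℕ → ℚ} → (∀ i → i < n → f i ≡ g i) → sumℕ n f ≡ sumℕ n g
sumℕ-cong< zero    eq = refl
sumℕ-cong< (suc n) eq = cong₂ _+_ (eq 0 (s≤s z≤n)) (sumℕ-cong< n (λ i i<n → eq (suc i) (s≤s i<n)))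

sumℕ-cong : ∀ n {f g : ℕ → ℚ} → (∀ i → f i ≡ g i) → sumℕ n f ≡ sumℕ n g
sumℕ-cong n eq = sumℕ-cong< n (λ i _ → eq i)

sumℕ-last : ∀ n (f : ℕ → ℚ) → sumℕ (suc n) f ≡ sumℕ n f + f n
sumℕ-last zero    f = trans (ℚ.+-identityʳ (f 0)) (sym (ℚ.+-identityˡ (f 0)))
sumℕ-last (suc n) f = trans (cong (f 0 +_) (sumℕ-last n (λ i → f (suc i)))) (sym (ℚ.+-assoc (f 0) _ _))

Δ : (ℕ → ℚ) → ℕ → ℚ
Δ x j = x j - x (suc j)

sumℕ-telescope : ∀ n (x : ℕ → ℚ) → sumℕ n (Δ x) ≡ x 0 - x n
sumℕ-telescope zero    x = sym (ℚ.+-inverseʳ (x 0))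
sumℕ-telescope (suc n) x = trans (cong (Δ x 0 +_) (sumℕ-telescope n (λ i → x (suc i)))) (collapse (x 0) (x 1) (x (suc n)))
  where
  collapse : ∀ a b c → (a - b) + (b - c) ≡ a - c
  collapse = solve-∀ ℚ-ring

sumℕ-telescope-from : ∀ (x : ℕ → ℚ) {s t} → s ≤ t → sumℕ (t ∸ s) (λ i → Δ x (s +ℕ i)) ≡ x s - x t
sumℕ-telescope-from x {s} {t} s≤t = begin
  sumℕ (t ∸ s) (λ i → Δ x (s +ℕ i))
    ≡⟨ sumℕ-cong (t ∸ s) (λ i → cong (λ j → x (s +ℕ i) - x j) (sym (ℕ.+-suc s i))) ⟩
  sumℕ (t ∸ s) (Δ (λ i → x (s +ℕ i)))
    ≡⟨ sumℕ-telescope (t ∸ s) (λ i → x (s +ℕ i)) ⟩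
  x (s +ℕ 0) - x (s +ℕ (t ∸ s))
    ≡⟨ cong₂ (λ i j → x i - x j) (ℕ.+-identityʳ s) (ℕ.m+[n∸m]≡n s≤t) ⟩
  x s - x t ∎
  where open ≡-Reasoning

nonneg*nonneg : ∀ {p q} → 0ℚ ≤ℚ p → 0ℚ ≤ℚ q → 0ℚ ≤ℚ p * q
nonneg*nonneg {p} {q} 0≤p 0≤q = ℚ.nonNegative⁻¹ (p * q) {{ℚ.nonNeg*nonNeg⇒nonNeg p {{nonNegative 0≤p}} q {{nonNegative 0≤q}}}}

square-nonneg : ∀ x → 0ℚ ≤ℚ x * x
square-nonneg x with ℚ.≤-total 0ℚ x
... | inj₁ 0≤x = nonneg*nonneg 0≤x 0≤x
... | inj₂ x≤0 = ℚ.nonNegative⁻¹ (x * x) {{ℚ.nonPos*nonPos⇒nonPos x {{nonPositive x≤0}} x {{nonPositive x≤0}}}}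

square≡0⇒≡0 : ∀ x → x * x ≡ 0ℚ → x ≡ 0ℚ
square≡0⇒≡0 x x²≡0 with ℚ.<-cmp x 0ℚ
... | tri≈ _ x≡0 _ = x≡0
... | tri< x<0 _ _ = ⊥-elim (ℚ.<-irrefl (sym x²≡0) (ℚ.positive⁻¹ (x * x) {{ℚ.neg*neg⇒pos x {{negative x<0}} x {{negative x<0}}}}))
... | tri> _ _ x>0 = ⊥-elim (ℚ.<-irrefl (sym x²≡0) (ℚ.positive⁻¹ (x * x) {{ℚ.pos*pos⇒pos x {{positive x>0}} x {{positive x>0}}}}))

0≤-⇒≤ : ∀ {x y} → 0ℚ ≤ℚ x - y → y ≤ℚ x
0≤-⇒≤ {x} {y} 0≤x-y = begin
  y              ≡⟨ sym (ℚ.+-identityˡ y) ⟩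
  0ℚ + y         ≤⟨ ℚ.+-monoˡ-≤ y 0≤x-y ⟩
  (x - y) + y    ≡⟨ cancel x y ⟩
  x              ∎
  where
  open ℚ.≤-Reasoning
  cancel : ∀ x y → (x - y) + y ≡ x
  cancel = solve-∀ ℚ-ring

≤⇒0≤- : ∀ {x y} → y ≤ℚ x → 0ℚ ≤ℚ x - y
≤⇒0≤- {x} {y} y≤x = ℚ.≤-trans (ℚ.≤-reflexive (sym (ℚ.+-inverseʳ y))) (ℚ.+-monoˡ-≤ (- y) y≤x)

nonneg+nonneg≡0⇒≡0 : ∀ {a b} → 0ℚ ≤ℚ a → 0ℚ ≤ℚ b → a + b ≡ 0ℚ → a ≡ 0ℚ
nonneg+nonneg≡0⇒≡0 {a} {b} 0≤a 0≤b a+b≡0 = ℚ.≤-antisym a≤0 0≤a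
  where
  open ℚ.≤-Reasoning
  a≤0 : a ≤ℚ 0ℚ
  a≤0 = begin a ≡⟨ sym (ℚ.+-identityʳ a) ⟩ a + 0ℚ ≤⟨ ℚ.+-monoʳ-≤ a 0≤b ⟩ a + b ≡⟨ a+b≡0 ⟩ 0ℚ ∎

sumℕ-nonneg : ∀ n {f : ℕ → ℚ} → (∀ i → 0ℚ ≤ℚ f i) → 0ℚ ≤ℚ sumℕ n f
sumℕ-nonneg zero    f≥0 = ℚ.≤-refl
sumℕ-nonneg (suc n) f≥0 = ℚ.+-mono-≤ (f≥0 0) (sumℕ-nonneg n (λ i → f≥0 (suc i)))

sumℕ-nonneg≡0⇒≡0 : ∀ n {f : ℕ → ℚ} → (∀ i → 0ℚ ≤ℚ f i) → sumℕ n f ≡ 0ℚ → ∀ i → i < n → f i ≡ 0ℚ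
sumℕ-nonneg≡0⇒≡0 (suc n) {f} f≥0 sum≡0 zero    _         =
  nonneg+nonneg≡0⇒≡0 (f≥0 0) (sumℕ-nonneg n (λ i → f≥0 (suc i))) sum≡0
sumℕ-nonneg≡0⇒≡0 (suc n) {f} f≥0 sum≡0 (suc i) (s≤s i<n) =
  sumℕ-nonneg≡0⇒≡0 n (λ i → f≥0 (suc i)) tail≡0 i i<n
  where
  tail≡0 : sumℕ n (λ i → f (suc i)) ≡ 0ℚ
  tail≡0 = nonneg+nonneg≡0⇒≡0 (sumℕ-nonneg n (λ i → f≥0 (suc i))) (f≥0 0)
    (trans (ℚ.+-comm _ (f 0)) sum≡0)

sumℕ-mono-length : ∀ {m k} {f : ℕ → ℚ} → (∀ i → 0ℚ ≤ℚ f i) → m ≤ k → sumℕ m f ≤ℚ sumℕ k f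
sumℕ-mono-length {k = k} f≥0 z≤n       = sumℕ-nonneg k f≥0
sumℕ-mono-length {f = f} f≥0 (s≤s m≤k) = ℚ.+-monoʳ-≤ (f 0) (sumℕ-mono-length (λ i → f≥0 (suc i)) m≤k)

sumℕ-window-≤ : ∀ s {m k} {f : ℕ → ℚ} → (∀ i → 0ℚ ≤ℚ f i) → s +ℕ m ≤ k → sumℕ m (λ i → f (s +ℕ i)) ≤ℚ sumℕ k f
sumℕ-window-≤ zero    f≥0 m≤k = sumℕ-mono-length f≥0 m≤k
sumℕ-window-≤ (suc s) {m} {suc k} {f} f≥0 (s≤s s+m≤k) = begin
  sumℕ m (λ i → f (suc s +ℕ i))   ≤⟨ sumℕ-window-≤ s (λ i → f≥0 (suc i)) s+m≤k ⟩
  sumℕ k (λ i → f (suc i))        ≡⟨ sym (ℚ.+-identityˡ _) ⟩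
  0ℚ + sumℕ k (λ i → f (suc i))   ≤⟨ ℚ.+-monoˡ-≤ _ (f≥0 0) ⟩
  sumℕ (suc k) f                  ∎
  where open ℚ.≤-Reasoning

extend : ∀ {n} → (Fin n → ℚ) → ℕ → ℚ
extend {zero}  f _       = 0ℚ
extend {suc n} f zero    = f zero
extend {suc n} f (suc j) = extend (λ i → f (suc i)) j

extend-toℕ : ∀ {n} (f : Fin n → ℚ) (i : Fin n) → extend f (toℕ i) ≡ f i
extend-toℕ {suc n} f zero    = refl
extend-toℕ {suc n} f (suc i) = extend-toℕ (λ i → f (suc i)) i

extend-tabulate : ∀ n (Z : ℕ → ℚ) {j} → j < n → extend {n} (λ i → Z (toℕ i)) j ≡ Z j
extend-tabulate (suc n) Z {zero}  _         = refl
extend-tabulate (suc n) Z {suc j} (s≤s j<n) = extend-tabulate n (λ i → Z (suc i)) j<n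

adjacentℕ : ℕ → ℕ → ℚ
adjacentℕ j l = if (0 <ᵇ ∣ j - l ∣) ∧ (∣ j - l ∣ ≤ᵇ 2) then 1ℚ else 0ℚ

adjacency-sym : ∀ n (i j : Fin n) → adjacency n i j ≡ adjacency n j i
adjacency-sym n i j = cong (λ d → if (0 <ᵇ d) ∧ (d ≤ᵇ 2) then 1ℚ else 0ℚ) (ℕ.∣-∣-comm (toℕ i) (toℕ j))

laplacian≡D-A : ∀ n (m i : Fin n) → laplacian n m i ≡ δ m i * degree n m - adjacency n m i
laplacian≡D-A n m i with ⌊ m ≟ i ⌋
... | true  = cong (_- adjacency n m i) (sym (ℚ.*-identityˡ (degree n m)))
... | false = absorb (degree n m) (adjacency n m i)
  where
  absorb : ∀ d a → - a ≡ 0ℚ * d - a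
  absorb = solve-∀ ℚ-ring

laplacian-off-diagonal : ∀ n {i j : Fin n} → i ≢ j → laplacian n i j ≡ - adjacency n i j
laplacian-off-diagonal n {i} {j} i≢j with i ≟ j
... | yes i≡j = ⊥-elim (i≢j i≡j)
... | no _    = refl

laplacian-sym : ∀ n (i j : Fin n) → laplacian n i j ≡ laplacian n j i
laplacian-sym n i j = by-cases (i ≟ j)
  where
  open ≡-Reasoning
  by-cases : Dec (i ≡ j) → laplacian n i j ≡ laplacian n j i
  by-cases (yes i≡j) = cong₂ (laplacian n) i≡j (sym i≡j)
  by-cases (no i≢j)  = begin
    laplacian n i j      ≡⟨ laplacian-off-diagonal n i≢j ⟩
    - adjacency n i j    ≡⟨ cong -_ (adjacency-sym n i j) ⟩
    - adjacency n j i    ≡⟨ sym (laplacian-off-diagonal n (λ j≡i → i≢j (sym j≡i))) ⟩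
    laplacian n j i      ∎

laplacian-row : ∀ n (m : Fin n) (x : Fin n → ℚ) →
  sum (λ i → laplacian n m i * x i) ≡ sum (λ i → adjacency n m i * (x m - x i))
laplacian-row n m x = begin
  sum (λ i → laplacian n m i * x i)
    ≡⟨ sum-cong-≋ (λ i → trans (cong (_* x i) (laplacian≡D-A n m i)) (expand (δ m i) (degree n m) (adjacency n m i) (x i))) ⟩
  sum (λ i → degree n m * (δ m i * x i) - a i * x i)
    ≡⟨ ∑-distrib-- (λ i → degree n m * (δ m i * x i)) (λ i → a i * x i) ⟩
  sum (λ i → degree n m * (δ m i * x i)) - sum (λ i → a i * x i)
    ≡⟨ cong (_- sum (λ i → a i * x i)) (trans (sym (*-distribˡ-sum (degree n m) (λ i → δ m i * x i))) (cong (degree n m *_) picks-xm)) ⟩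
  degree n m * x m - sum (λ i → a i * x i)
    ≡⟨ cong (λ d → d * x m - sum (λ i → a i * x i)) (Σ≡sum a) ⟩
  sum a * x m - sum (λ i → a i * x i)
    ≡⟨ cong (_- sum (λ i → a i * x i)) (*-distribʳ-sum (x m) a) ⟩
  sum (λ i → a i * x m) - sum (λ i → a i * x i)
    ≡⟨ sym (∑-distrib-- (λ i → a i * x m) (λ i → a i * x i)) ⟩
  sum (λ i → a i * x m - a i * x i)
    ≡⟨ sum-cong-≋ (λ i → factor (a i) (x m) (x i)) ⟩
  sum (λ i → a i * (x m - x i)) ∎
  where
  open ≡-Reasoning
  a : Fin n → ℚ
  a = adjacency n m
  picks-xm : sum (λ i → δ m i * x i) ≡ x m
  picks-xm = trans (sum-cong-≋ (λ i → cong (_* x i) (δ-sym m i))) (sum-δ m x)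
  expand : ∀ e d b y → (e * d - b) * y ≡ d * (e * y) - b * y
  expand = solve-∀ ℚ-ring
  factor : ∀ b p q → b * p - b * q ≡ b * (p - q)
  factor = solve-∀ ℚ-ring

edgeSum : ℕ → (ℕ → ℕ → ℚ) → ℚ
edgeSum N h = sumℕ (pred N) (λ j → h j (suc j) + h (suc j) j)
            + sumℕ (N ∸ 2) (λ j → h j (suc (suc j)) + h (suc (suc j)) j)

sum-neighbours-of-0 : ∀ M (g : ℕ → ℚ) → sumℕ (suc (suc M)) (λ l → adjacentℕ 0 (suc l) * g l) ≡ g 0 + g 1
sum-neighbours-of-0 M g = begin
  1ℚ * g 0 + (1ℚ * g 1 + sumℕ M (λ l → 0ℚ * g (suc (suc l))))
    ≡⟨ cong (λ t → 1ℚ * g 0 + (1ℚ * g 1 + t)) (trans (sumℕ-cong M (λ l → ℚ.*-zeroˡ (g (suc (suc l))))) (sum-replicate-zero M)) ⟩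
  1ℚ * g 0 + (1ℚ * g 1 + 0ℚ)
    ≡⟨ simplify (g 0) (g 1) ⟩
  g 0 + g 1 ∎
  where
  open ≡-Reasoning
  simplify : ∀ a b → 1ℚ * a + (1ℚ * b + 0ℚ) ≡ a + b
  simplify = solve-∀ ℚ-ring

sum-adjacent-pairs : ∀ N (h : ℕ → ℕ → ℚ) →
  sumℕ N (λ j → sumℕ N (λ l → adjacentℕ j l * h j l)) ≡ edgeSum N h
sum-adjacent-pairs zero h = refl
sum-adjacent-pairs 1 h = one-vertex (h 0 0)
  where
  one-vertex : ∀ a → 0ℚ * a + 0ℚ + 0ℚ ≡ 0ℚ + 0ℚ
  one-vertex = solve-∀ ℚ-ring
sum-adjacent-pairs 2 h = two-vertices (h 0 0) (h 0 1) (h 1 0) (h 1 1)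
  where
  two-vertices : ∀ a b c d → (0ℚ * a + (1ℚ * b + 0ℚ)) + ((1ℚ * c + (0ℚ * d + 0ℚ)) + 0ℚ) ≡ (b + c + 0ℚ) + 0ℚ
  two-vertices = solve-∀ ℚ-ring
sum-adjacent-pairs (suc (suc (suc M))) h = begin
  (0ℚ * h 0 0 + row) + sumℕ N (λ j → adjacentℕ 0 (suc j) * h (suc j) 0 + sumℕ N (λ l → adjacentℕ j l * h (suc j) (suc l)))
    ≡⟨ cong ((0ℚ * h 0 0 + row) +_) (sumℕ-distrib-+ N (λ j → adjacentℕ 0 (suc j) * h (suc j) 0)
                                                       (λ j → sumℕ N (λ l → adjacentℕ j l * h (suc j) (suc l)))) ⟩
  (0ℚ * h 0 0 + row)
    + (sumℕ N (λ j → adjacentℕ 0 (suc j) * h (suc j) 0) + sumℕ N (λ j → sumℕ N (λ l → adjacentℕ j l * h (suc j) (suc l))))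
    ≡⟨ cong₂ (λ r c → (0ℚ * h 0 0 + r) + c)
         (sum-neighbours-of-0 M (λ l → h 0 (suc l)))
         (cong₂ _+_ (sum-neighbours-of-0 M (λ j → h (suc j) 0)) (sum-adjacent-pairs (suc (suc M)) (λ j l → h (suc j) (suc l)))) ⟩
  (0ℚ * h 0 0 + (h 0 1 + h 0 2)) + ((h 1 0 + h 2 0) + (A + B))
    ≡⟨ regroup (h 0 0) (h 0 1) (h 0 2) (h 1 0) (h 2 0) A B ⟩
  edgeSum (suc N) h ∎
  where
  open ≡-Reasoning
  N : ℕ
  N = suc (suc M)
  row A B : ℚ
  row = sumℕ N (λ l → adjacentℕ 0 (suc l) * h 0 (suc l))
  A = sumℕ (suc M) (λ j → h (suc j) (suc (suc j)) + h (suc (suc j)) (suc j))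
  B = sumℕ M (λ j → h (suc j) (suc (suc (suc j))) + h (suc (suc (suc j))) (suc j))
  regroup : ∀ z a b c d x y → (0ℚ * z + (a + b)) + ((c + d) + (x + y)) ≡ ((a + c) + x) + ((b + d) + y)
  regroup = solve-∀ ℚ-ring

-- The energy form in gap coordinates

-- The edge {i, i+1} contributes yᵢuᵢ and the edge {i, i+2} contributes (yᵢ + yᵢ₊₁)(uᵢ + uᵢ₊₁).
gapForm : ℕ → (ℕ → ℚ) → (ℕ → ℚ) → ℚ
gapForm m y u = sumℕ m (λ i → y i * u i) + sumℕ (m ∸ 1) (λ i → (y i + y (suc i)) * (u i + u (suc i)))

laplacian-form : ∀ k (z x : Fin (suc k) → ℚ) →
  sum (λ m → z m * sum (λ i → laplacian (suc k) m i * x i)) ≡ gapForm k (Δ (extend z)) (Δ (extend x))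
laplacian-form k z x = begin
  sum (λ m → z m * sum (λ i → laplacian N m i * x i))
    ≡⟨ sum-cong-≋ (λ m → cong (z m *_) (laplacian-row N m x)) ⟩
  sum (λ m → z m * sum (λ i → adjacency N m i * (x m - x i)))
    ≡⟨ sum-cong-≋ (λ m → trans (*-distribˡ-sum (z m) (λ i → adjacency N m i * (x m - x i)))
                                (sum-cong-≋ (λ i → as-pair-term m i))) ⟩
  sumℕ N (λ j → sumℕ N (λ l → adjacentℕ j l * h j l))
    ≡⟨ sum-adjacent-pairs N h ⟩
  edgeSum N h
    ≡⟨ cong₂ _+_ (sumℕ-cong k (λ j → neighbours (Z j) (Z (suc j)) (X j) (X (suc j))))
                 (sumℕ-cong (k ∸ 1) (λ j → second-neighbours (Z j) (Z (suc j)) (Z (suc (suc j))) (X j) (X (suc j)) (X (suc (suc j))))) ⟩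
  gapForm k (Δ Z) (Δ X) ∎
  where
  open ≡-Reasoning
  N : ℕ
  N = suc k
  Z X : ℕ → ℚ
  Z = extend z
  X = extend x
  h : ℕ → ℕ → ℚ
  h j l = Z j * (X j - X l)
  swap : ∀ c a d → c * (a * d) ≡ a * (c * d)
  swap = solve-∀ ℚ-ring
  as-pair-term : ∀ m i → z m * (adjacency N m i * (x m - x i)) ≡ adjacentℕ (toℕ m) (toℕ i) * h (toℕ m) (toℕ i)
  as-pair-term m i = begin
    z m * (adjacency N m i * (x m - x i))
      ≡⟨ swap (z m) (adjacency N m i) (x m - x i) ⟩
    adjacency N m i * (z m * (x m - x i))
      ≡⟨ cong₂ (λ c d → adjacency N m i * (c * (d - x i))) (sym (extend-toℕ z m)) (sym (extend-toℕ x m)) ⟩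
    adjacency N m i * (Z (toℕ m) * (X (toℕ m) - x i))
      ≡⟨ cong (λ c → adjacency N m i * (Z (toℕ m) * (X (toℕ m) - c))) (sym (extend-toℕ x i)) ⟩
    adjacentℕ (toℕ m) (toℕ i) * h (toℕ m) (toℕ i) ∎
  neighbours : ∀ z₀ z₁ x₀ x₁ → z₀ * (x₀ - x₁) + z₁ * (x₁ - x₀) ≡ (z₀ - z₁) * (x₀ - x₁)
  neighbours = solve-∀ ℚ-ring
  second-neighbours : ∀ z₀ z₁ z₂ x₀ x₁ x₂ →
    z₀ * (x₀ - x₂) + z₂ * (x₂ - x₀) ≡ ((z₀ - z₁) + (z₁ - z₂)) * ((x₀ - x₁) + (x₁ - x₂))
  second-neighbours = solve-∀ ℚ-ring

gapForm-sym : ∀ m y u → gapForm m y u ≡ gapForm m u y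
gapForm-sym m y u = cong₂ _+_ (sumℕ-cong m (λ i → ℚ.*-comm (y i) (u i)))
                              (sumℕ-cong (m ∸ 1) (λ i → ℚ.*-comm (y i + y (suc i)) (u i + u (suc i))))

gapForm-congˡ< : ∀ m {y y′ : ℕ → ℚ} (u : ℕ → ℚ) → (∀ i → i < m → y i ≡ y′ i) → gapForm m y u ≡ gapForm m y′ u
gapForm-congˡ< zero    u eq = refl
gapForm-congˡ< (suc m) u eq = cong₂ _+_
  (sumℕ-cong< (suc m) (λ i i<m → cong (_* u i) (eq i i<m)))
  (sumℕ-cong< m (λ i i<m → cong (_* (u i + u (suc i))) (cong₂ _+_ (eq i (ℕ.m<n⇒m<1+n i<m)) (eq (suc i) (s≤s i<m)))))

gapForm-nonneg : ∀ m y → 0ℚ ≤ℚ gapForm m y y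
gapForm-nonneg m y = ℚ.+-mono-≤ (sumℕ-nonneg m (λ i → square-nonneg (y i)))
                                (sumℕ-nonneg (m ∸ 1) (λ i → square-nonneg (y i + y (suc i))))

sumℕ-square-expand : ∀ n (p q : ℕ → ℚ) → sumℕ n (λ i → (p i - q i) * (p i - q i))
  ≡ (sumℕ n (λ i → p i * p i) + sumℕ n (λ i → q i * q i)) - (sumℕ n (λ i → p i * q i) + sumℕ n (λ i → p i * q i))
sumℕ-square-expand zero    p q = refl
sumℕ-square-expand (suc n) p q =
  trans (cong ((p 0 - q 0) * (p 0 - q 0) +_) (sumℕ-square-expand n (λ i → p (suc i)) (λ i → q (suc i))))
        (regroup (p 0) (q 0) _ _ _)
  where
  regroup : ∀ a b x y z → (a - b) * (a - b) + ((x + y) - (z + z)) ≡ ((a * a + x) + (b * b + y)) - ((a * b + z) + (a * b + z))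
  regroup = solve-∀ ℚ-ring

gapForm-expand : ∀ m (y w : ℕ → ℚ) → gapForm m (λ i → y i - w i) (λ i → y i - w i)
  ≡ (gapForm m y y + gapForm m w w) - (gapForm m y w + gapForm m y w)
gapForm-expand m y w = begin
  gapForm m (λ i → y i - w i) (λ i → y i - w i)
    ≡⟨ cong (sumℕ m (λ i → (y i - w i) * (y i - w i)) +_)
            (sumℕ-cong (m ∸ 1) (λ i → cong (λ t → t * t) (interchange (y i) (w i) (y (suc i)) (w (suc i))))) ⟩
  sumℕ m (λ i → (y i - w i) * (y i - w i)) + sumℕ (m ∸ 1) (λ i → (p i - q i) * (p i - q i))
    ≡⟨ cong₂ _+_ (sumℕ-square-expand m y w) (sumℕ-square-expand (m ∸ 1) p q) ⟩
  ((Syy + Sww) - (Syw + Syw)) + ((Ppp + Pqq) - (Ppq + Ppq))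
    ≡⟨ regroup Syy Sww Syw Ppp Pqq Ppq ⟩
  (gapForm m y y + gapForm m w w) - (gapForm m y w + gapForm m y w) ∎
  where
  open ≡-Reasoning
  p q : ℕ → ℚ
  p i = y i + y (suc i)
  q i = w i + w (suc i)
  Syy Sww Syw Ppp Pqq Ppq : ℚ
  Syy = sumℕ m (λ i → y i * y i)
  Sww = sumℕ m (λ i → w i * w i)
  Syw = sumℕ m (λ i → y i * w i)
  Ppp = sumℕ (m ∸ 1) (λ i → p i * p i)
  Pqq = sumℕ (m ∸ 1) (λ i → q i * q i)
  Ppq = sumℕ (m ∸ 1) (λ i → p i * q i)
  interchange : ∀ a b c d → (a - b) + (c - d) ≡ (a + c) - (b + d)
  interchange = solve-∀ ℚ-ring
  regroup : ∀ a b c x y z → ((a + b) - (c + c)) + ((x + y) - (z + z)) ≡ ((a + x) + (b + y)) - ((c + z) + (c + z))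
  regroup = solve-∀ ℚ-ring

gapForm-cross-≤ : ∀ m (y w : ℕ → ℚ) → (gapForm m y w + gapForm m y w) - gapForm m y y ≤ℚ gapForm m w w
gapForm-cross-≤ m y w = 0≤-⇒≤ (begin
  0ℚ                                          ≤⟨ gapForm-nonneg m (λ i → y i - w i) ⟩
  gapForm m (λ i → y i - w i) (λ i → y i - w i) ≡⟨ gapForm-expand m y w ⟩
  (Qyy + Qww) - (Qyw + Qyw)                   ≡⟨ regroup Qyy Qww Qyw ⟩
  Qww - ((Qyw + Qyw) - Qyy)                   ∎)
  where
  open ℚ.≤-Reasoning
  Qyy Qww Qyw : ℚ
  Qyy = gapForm m y y
  Qww = gapForm m w w
  Qyw = gapForm m y w
  regroup : ∀ a b c → (a + b) - (c + c) ≡ b - ((c + c) - a)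
  regroup = solve-∀ ℚ-ring

gapForm-dual-bound : ∀ m (y w : ℕ → ℚ) {r} → gapForm m y y ≤ℚ r → gapForm m y w ≡ r → r ≤ℚ gapForm m w w
gapForm-dual-bound m y w {r} Qyy≤r Qyw≡r = begin
  r                                           ≡⟨ double-minus r ⟩
  (r + r) - r                                 ≤⟨ ℚ.+-monoʳ-≤ (r + r) (ℚ.neg-antimono-≤ Qyy≤r) ⟩
  (r + r) - gapForm m y y                     ≡⟨ cong (λ t → (t + t) - gapForm m y y) (sym Qyw≡r) ⟩
  (gapForm m y w + gapForm m y w) - gapForm m y y ≤⟨ gapForm-cross-≤ m y w ⟩
  gapForm m w w                               ∎
  where
  open ℚ.≤-Reasoning
  double-minus : ∀ a → a ≡ (a + a) - a
  double-minus = solve-∀ ℚ-ring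

gapForm-window-≤ : ∀ s m {k} (y : ℕ → ℚ) → s +ℕ m ≤ k →
  gapForm m (λ i → y (s +ℕ i)) (λ i → y (s +ℕ i)) ≤ℚ gapForm k y y
gapForm-window-≤ s zero    {k}     y _ = ℚ.≤-trans (ℚ.≤-reflexive (ℚ.+-identityʳ 0ℚ)) (gapForm-nonneg k y)
gapForm-window-≤ s (suc m) {zero}  y s+m<0 = ⊥-elim (ℕ.n≮0 (subst (_≤ 0) (ℕ.+-suc s m) s+m<0))
gapForm-window-≤ s (suc m) {suc k} y s+m<k = ℚ.+-mono-≤
  (sumℕ-window-≤ s (λ i → square-nonneg (y i)) s+m<k)
  (ℚ.≤-trans (ℚ.≤-reflexive (sumℕ-cong m (λ i → cong (λ j → (y (s +ℕ i) + y j) * (y (s +ℕ i) + y j)) (ℕ.+-suc s i))))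
             (sumℕ-window-≤ s (λ i → square-nonneg (y i + y (suc i))) (ℕ.≤-pred (subst (_≤ suc k) (ℕ.+-suc s m) s+m<k))))

Δ≡0⇒constant : ∀ k (x : ℕ → ℚ) → (∀ j → j < k → Δ x j ≡ 0ℚ) → ∀ j → j ≤ k → x j ≡ x 0
Δ≡0⇒constant k x Δx≡0 zero    _   = refl
Δ≡0⇒constant k x Δx≡0 (suc j) j<k =
  trans (sym (x∙y⁻¹≈ε⇒x≈y (x j) (x (suc j)) (Δx≡0 j j<k))) (Δ≡0⇒constant k x Δx≡0 j (ℕ.<⇒≤ j<k))

laplacian-kernel-constant : ∀ k (c : Fin (suc k) → ℚ) →
  (∀ m → sum (λ i → laplacian (suc k) m i * c i) ≡ 0ℚ) → ∀ i → c i ≡ c zero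
laplacian-kernel-constant k c Lc≡0 i =
  trans (sym (extend-toℕ c i)) (Δ≡0⇒constant k C ΔC≡0 (toℕ i) (toℕ≤pred[n] i))
  where
  C : ℕ → ℚ
  C = extend c
  form≡0 : gapForm k (Δ C) (Δ C) ≡ 0ℚ
  form≡0 = begin
    gapForm k (Δ C) (Δ C)                                        ≡⟨ sym (laplacian-form k c c) ⟩
    sum (λ m → c m * sum (λ i → laplacian (suc k) m i * c i))    ≡⟨ sum-cong-≋ (λ m → trans (cong (c m *_) (Lc≡0 m)) (ℚ.*-zeroʳ (c m))) ⟩
    sum {suc k} (λ _ → 0ℚ)                                        ≡⟨ sum-replicate-zero (suc k) ⟩
    0ℚ                                                           ∎
    where open ≡-Reasoning
  squares≡0 : sumℕ k (λ j → Δ C j * Δ C j) ≡ 0ℚ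
  squares≡0 = nonneg+nonneg≡0⇒≡0 (sumℕ-nonneg k (λ j → square-nonneg (Δ C j)))
                                  (sumℕ-nonneg (k ∸ 1) (λ j → square-nonneg (Δ C j + Δ C (suc j)))) form≡0
  ΔC≡0 : ∀ j → j < k → Δ C j ≡ 0ℚ
  ΔC≡0 j j<k = square≡0⇒≡0 (Δ C j) (sumℕ-nonneg≡0⇒≡0 k (λ j → square-nonneg (Δ C j)) squares≡0 j j<k)

-- Potentials from the Penrose conditions

sum-weighted-eDiff : ∀ {n} (a b : Fin n) (z : Fin n → ℚ) → sum (λ m → z m * eDiff a b m) ≡ z a - z b
sum-weighted-eDiff a b z = begin
  sum (λ m → z m * eDiff a b m)              ≡⟨ sum-cong-≋ (λ m → distrib (z m) (δ m a) (δ m b)) ⟩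
  sum (λ m → δ m a * z m - δ m b * z m)      ≡⟨ ∑-distrib-- (λ m → δ m a * z m) (λ m → δ m b * z m) ⟩
  sum (λ m → δ m a * z m) - sum (λ m → δ m b * z m) ≡⟨ cong₂ _-_ (sum-δ a z) (sum-δ b z) ⟩
  z a - z b                                  ∎
  where
  open ≡-Reasoning
  distrib : ∀ x p q → x * (p - q) ≡ p * x - q * x
  distrib = solve-∀ ℚ-ring

resistance-sym : ∀ {n} (X : Matrix n) a b → resistance X a b ≡ resistance X b a
resistance-sym X a b = Σ-cong (λ i → Σ-cong (λ j → flip (δ i a) (δ i b) (X i j) (δ j a) (δ j b)))
  where
  Σ-cong : ∀ {n} {f g : Fin n → ℚ} → (∀ i → f i ≡ g i) → Σ f ≡ Σ g
  Σ-cong {f = f} {g} f≗g = trans (Σ≡sum f) (trans (sum-cong-≋ f≗g) (sym (Σ≡sum g)))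
  flip : ∀ p q x r s → (p - q) * x * (r - s) ≡ (q - p) * x * (s - r)
  flip = solve-∀ ℚ-ring

module MoorePenrose (k : ℕ) (X : Matrix (suc k)) (mp : IsMoorePenroseInverse (laplacian (suc k)) X) where
  open IsMoorePenroseInverse mp

  private
    N : ℕ
    N = suc k
    L : Matrix N
    L = laplacian N

  LX : Matrix N
  LX i j = sum (λ l → L i l * X l j)

  LX-sym : ∀ i j → LX i j ≡ LX j i
  LX-sym i j = trans (sym (Σ≡sum (λ l → L i l * X l j))) (trans (sym (p3 i j)) (Σ≡sum (λ l → L j l * X l i)))

  LXL≡L : ∀ i j → sum (λ l → LX i l * L l j) ≡ L i j
  LXL≡L i j = begin
    sum (λ l → LX i l * L l j)                   ≡⟨ sum-cong-≋ (λ l → cong (_* L l j) (sym (Σ≡sum (λ m → L i m * X m l)))) ⟩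
    sum (λ l → Σ (λ m → L i m * X m l) * L l j)  ≡⟨ sym (Σ≡sum (λ l → Σ (λ m → L i m * X m l) * L l j)) ⟩
    ((L · X) · L) i j                            ≡⟨ p1 i j ⟩
    L i j                                        ∎
    where open ≡-Reasoning

  private
    C : Matrix N
    C i j = δ i j - LX i j

    L-annihilates-C : ∀ j m → sum (λ i → L m i * C i j) ≡ 0ℚ
    L-annihilates-C j m = begin
      sum (λ i → L m i * C i j)                               ≡⟨ sum-cong-≋ (λ i → distrib i) ⟩
      sum (λ i → δ i j * L m i - LX j i * L i m)              ≡⟨ ∑-distrib-- (λ i → δ i j * L m i) (λ i → LX j i * L i m) ⟩
      sum (λ i → δ i j * L m i) - sum (λ i → LX j i * L i m)  ≡⟨ cong₂ _-_ (sum-δ j (L m)) (LXL≡L j m) ⟩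
      L m j - L j m                                           ≡⟨ cong (λ t → L m j - t) (laplacian-sym N j m) ⟩
      L m j - L m j                                           ≡⟨ ℚ.+-inverseʳ (L m j) ⟩
      0ℚ                                                      ∎
      where
      open ≡-Reasoning
      expand : ∀ l e t → l * (e - t) ≡ e * l - t * l
      expand = solve-∀ ℚ-ring
      distrib : ∀ i → L m i * C i j ≡ δ i j * L m i - LX j i * L i m
      distrib i = trans (expand (L m i) (δ i j) (LX i j)) (cong₂ (λ t l → δ i j * L m i - t * l) (LX-sym i j) (laplacian-sym N m i))

    C-sym : ∀ i j → C i j ≡ C j i
    C-sym i j = cong₂ _-_ (δ-sym i j) (LX-sym i j)

    C-constant : ∀ i j → C i j ≡ C zero zero
    C-constant i j = begin
      C i j       ≡⟨ laplacian-kernel-constant k (λ i → C i j) (L-annihilates-C j) i ⟩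
      C zero j    ≡⟨ C-sym zero j ⟩
      C j zero    ≡⟨ laplacian-kernel-constant k (λ i → C i zero) (L-annihilates-C zero) j ⟩
      C zero zero ∎
      where open ≡-Reasoning

  LX≡δ-α : ∀ i j → LX i j ≡ δ i j - C zero zero
  LX≡δ-α i j = trans (undo (δ i j) (LX i j)) (cong (λ c → δ i j - c) (C-constant i j))
    where
    undo : ∀ e t → t ≡ e - (e - t)
    undo = solve-∀ ℚ-ring

  module Potential (a b : Fin N) where
    d : Fin N → ℚ
    d = eDiff a b

    v : Fin N → ℚ
    v i = sum (λ j → X i j * d j)

    sum-d≡0 : sum d ≡ 0ℚ
    sum-d≡0 = trans (sum-cong-≋ (λ m → sym (ℚ.*-identityˡ (d m))))
                    (trans (sum-weighted-eDiff a b (λ _ → 1ℚ)) (ℚ.+-inverseʳ 1ℚ))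

    Lv≡d : ∀ i → sum (λ l → L i l * v l) ≡ d i
    Lv≡d i = begin
      sum (λ l → L i l * v l)
        ≡⟨ sum-cong-≋ (λ l → trans (*-distribˡ-sum (L i l) (λ j → X l j * d j))
                                   (sum-cong-≋ (λ j → sym (ℚ.*-assoc (L i l) (X l j) (d j))))) ⟩
      sum (λ l → sum (λ j → L i l * X l j * d j))
        ≡⟨ ∑-comm (λ l j → L i l * X l j * d j) ⟩
      sum (λ j → sum (λ l → L i l * X l j * d j))
        ≡⟨ sum-cong-≋ (λ j → sym (*-distribʳ-sum (d j) (λ l → L i l * X l j))) ⟩
      sum (λ j → LX i j * d j)
        ≡⟨ sum-cong-≋ (λ j → trans (cong (_* d j) (LX≡δ-α i j)) (distrib (δ i j) (C zero zero) (d j))) ⟩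
      sum (λ j → δ i j * d j - C zero zero * d j)
        ≡⟨ ∑-distrib-- (λ j → δ i j * d j) (λ j → C zero zero * d j) ⟩
      sum (λ j → δ i j * d j) - sum (λ j → C zero zero * d j)
        ≡⟨ cong₂ _-_ (trans (sum-cong-≋ (λ j → cong (_* d j) (δ-sym i j))) (sum-δ i d))
                     (trans (sym (*-distribˡ-sum (C zero zero) d)) (trans (cong (C zero zero *_) sum-d≡0) (ℚ.*-zeroʳ (C zero zero)))) ⟩
      d i - 0ℚ
        ≡⟨ minus-zero (d i) ⟩
      d i ∎
      where
      open ≡-Reasoning
      distrib : ∀ e c x → (e - c) * x ≡ e * x - c * x
      distrib = solve-∀ ℚ-ring
      minus-zero : ∀ x → x - 0ℚ ≡ x
      minus-zero = solve-∀ ℚ-ring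

    resistance≡drop : resistance X a b ≡ v a - v b
    resistance≡drop = begin
      Σ (λ i → Σ (λ j → d i * X i j * d j))
        ≡⟨ Σ≡sum (λ i → Σ (λ j → d i * X i j * d j)) ⟩
      sum (λ i → Σ (λ j → d i * X i j * d j))
        ≡⟨ sum-cong-≋ (λ i → trans (Σ≡sum (λ j → d i * X i j * d j)) (sum-cong-≋ (λ j → ℚ.*-assoc (d i) (X i j) (d j)))) ⟩
      sum (λ i → sum (λ j → d i * (X i j * d j)))
        ≡⟨ sum-cong-≋ (λ i → trans (sym (*-distribˡ-sum (d i) (λ j → X i j * d j))) (ℚ.*-comm (d i) (v i))) ⟩
      sum (λ i → v i * d i)
        ≡⟨ sum-weighted-eDiff a b v ⟩
      v a - v b ∎
      where open ≡-Reasoning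

    energy : ∀ (z : Fin N → ℚ) → gapForm k (Δ (extend z)) (Δ (extend v)) ≡ z a - z b
    energy z = begin
      gapForm k (Δ (extend z)) (Δ (extend v))       ≡⟨ sym (laplacian-form k z v) ⟩
      sum (λ m → z m * sum (λ l → L m l * v l))     ≡⟨ sum-cong-≋ (λ m → cong (z m *_) (Lv≡d m)) ⟩
      sum (λ m → z m * d m)                         ≡⟨ sum-weighted-eDiff a b z ⟩
      z a - z b                                     ∎
      where open ≡-Reasoning

-- The representer of the sum functional

gapForm-by-rows : ∀ M (u w : ℕ → ℚ) → let c = λ i → w i + w (suc i) in
  gapForm (suc (suc M)) u w
    ≡ u 0 * (w 0 + c 0) + sumℕ M (λ i → u (suc i) * (w (suc i) + c (suc i) + c i)) + u (suc M) * (w (suc M) + c M)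
gapForm-by-rows M u w = begin
  sumℕ (suc (suc M)) (λ i → u i * w i) + sumℕ (suc M) (λ i → (u i + u (suc i)) * c i)
    ≡⟨ cong₂ _+_ (cong (u 0 * w 0 +_) (sumℕ-last M (λ i → u (suc i) * w (suc i))))
                 (trans (sumℕ-cong (suc M) (λ i → ℚ.*-distribʳ-+ (c i) (u i) (u (suc i))))
                 (trans (sumℕ-distrib-+ (suc M) (λ i → u i * c i) (λ i → u (suc i) * c i))
                        (cong (u 0 * c 0 + A₂ +_) (sumℕ-last M (λ i → u (suc i) * c i))))) ⟩
  (u 0 * w 0 + (A₁ + u (suc M) * w (suc M))) + ((u 0 * c 0 + A₂) + (A₃ + u (suc M) * c M))
    ≡⟨ regroup (u 0) (w 0) (c 0) A₁ A₂ A₃ (u (suc M)) (w (suc M)) (c M) ⟩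
  u 0 * (w 0 + c 0) + ((A₁ + A₂) + A₃) + u (suc M) * (w (suc M) + c M)
    ≡⟨ cong (λ t → u 0 * (w 0 + c 0) + t + u (suc M) * (w (suc M) + c M)) merge ⟩
  u 0 * (w 0 + c 0) + sumℕ M (λ i → u (suc i) * (w (suc i) + c (suc i) + c i)) + u (suc M) * (w (suc M) + c M) ∎
  where
  open ≡-Reasoning
  c : ℕ → ℚ
  c i = w i + w (suc i)
  A₁ A₂ A₃ : ℚ
  A₁ = sumℕ M (λ i → u (suc i) * w (suc i))
  A₂ = sumℕ M (λ i → u (suc i) * c (suc i))
  A₃ = sumℕ M (λ i → u (suc i) * c i)
  regroup : ∀ u₀ w₀ c₀ a₁ a₂ a₃ uₗ wₗ cₗ →
    (u₀ * w₀ + (a₁ + uₗ * wₗ)) + ((u₀ * c₀ + a₂) + (a₃ + uₗ * cₗ)) ≡ u₀ * (w₀ + c₀) + ((a₁ + a₂) + a₃) + uₗ * (wₗ + cₗ)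
  regroup = solve-∀ ℚ-ring
  factor : ∀ x a b d → x * a + x * b + x * d ≡ x * (a + b + d)
  factor = solve-∀ ℚ-ring
  merge : (A₁ + A₂) + A₃ ≡ sumℕ M (λ i → u (suc i) * (w (suc i) + c (suc i) + c i))
  merge = begin
    (A₁ + A₂) + A₃
      ≡⟨ cong (_+ A₃) (sym (sumℕ-distrib-+ M (λ i → u (suc i) * w (suc i)) (λ i → u (suc i) * c (suc i)))) ⟩
    sumℕ M (λ i → u (suc i) * w (suc i) + u (suc i) * c (suc i)) + A₃
      ≡⟨ sym (sumℕ-distrib-+ M (λ i → u (suc i) * w (suc i) + u (suc i) * c (suc i)) (λ i → u (suc i) * c i)) ⟩
    sumℕ M (λ i → u (suc i) * w (suc i) + u (suc i) * c (suc i) + u (suc i) * c i)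
      ≡⟨ sumℕ-cong M (λ i → factor (u (suc i)) (w (suc i)) (c (suc i)) (c i)) ⟩
    sumℕ M (λ i → u (suc i) * (w (suc i) + c (suc i) + c i)) ∎

rows≡1⇒represents-sum : ∀ M (w : ℕ → ℚ) → let c = λ i → w i + w (suc i) in
  w 0 + c 0 ≡ 1ℚ →
  (∀ i → i < M → w (suc i) + c (suc i) + c i ≡ 1ℚ) →
  w (suc M) + c M ≡ 1ℚ →
  ∀ u → gapForm (suc (suc M)) u w ≡ sumℕ (suc (suc M)) u
rows≡1⇒represents-sum M w first inner last u = begin
  gapForm (suc (suc M)) u w
    ≡⟨ gapForm-by-rows M u w ⟩
  u 0 * (w 0 + c 0) + sumℕ M (λ i → u (suc i) * (w (suc i) + c (suc i) + c i)) + u (suc M) * (w (suc M) + c M)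
    ≡⟨ cong₂ (λ x z → u 0 * x + sumℕ M (λ i → u (suc i) * (w (suc i) + c (suc i) + c i)) + u (suc M) * z) first last ⟩
  u 0 * 1ℚ + sumℕ M (λ i → u (suc i) * (w (suc i) + c (suc i) + c i)) + u (suc M) * 1ℚ
    ≡⟨ cong (λ y → u 0 * 1ℚ + y + u (suc M) * 1ℚ)
            (sumℕ-cong< M (λ i i<M → trans (cong (u (suc i) *_) (inner i i<M)) (ℚ.*-identityʳ (u (suc i))))) ⟩
  u 0 * 1ℚ + sumℕ M (λ i → u (suc i)) + u (suc M) * 1ℚ
    ≡⟨ cong₂ (λ x y → x + sumℕ M (λ i → u (suc i)) + y) (ℚ.*-identityʳ (u 0)) (ℚ.*-identityʳ (u (suc M))) ⟩
  u 0 + sumℕ M (λ i → u (suc i)) + u (suc M)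
    ≡⟨ trans (ℚ.+-assoc (u 0) _ _) (cong (u 0 +_) (sym (sumℕ-last M (λ i → u (suc i))))) ⟩
  sumℕ (suc (suc M)) u ∎
  where
  open ≡-Reasoning
  c : ℕ → ℚ
  c i = w i + w (suc i)

2ℚ 3ℚ 5ℚ : ℚ
2ℚ = normalize 2 1
3ℚ = normalize 3 1
5ℚ = normalize 5 1

lucas : ℕ → ℚ
lucas zero                = 2ℚ
lucas (suc zero)          = 1ℚ
lucas (suc (suc n))       = lucas (suc n) + lucas n

lucas-pos : ∀ n → 0ℚ <ℚ lucas n
lucas-pos zero          = ℚ.positive⁻¹ 2ℚ
lucas-pos (suc zero)    = ℚ.positive⁻¹ 1ℚ
lucas-pos (suc (suc n)) = ℚ.+-mono-< (lucas-pos (suc n)) (lucas-pos n)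

lucas-nonneg : ∀ n → 0ℚ ≤ℚ lucas n
lucas-nonneg n = ℚ.<⇒≤ (lucas-pos n)

lucas-suc≤3*lucas : ∀ n → lucas (suc n) ≤ℚ 3ℚ * lucas n
lucas-suc≤3*lucas zero          = toWitness {a? = 1ℚ ℚ.≤? 3ℚ * 2ℚ} _
lucas-suc≤3*lucas (suc zero)    = toWitness {a? = 1ℚ + 2ℚ ℚ.≤? 3ℚ * 1ℚ} _
lucas-suc≤3*lucas (suc (suc n)) = 0≤-⇒≤ (ℚ.≤-trans
  (ℚ.+-mono-≤ (lucas-nonneg (suc n)) (ℚ.+-mono-≤ (lucas-nonneg n) (lucas-nonneg n)))
  (ℚ.≤-reflexive (margin (lucas (suc n)) (lucas n))))
  where
  margin : ∀ a b → a + (b + b) ≡ 3ℚ * (a + b) - ((a + b) + a)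
  margin = solve-∀ ℚ-ring

lucas-products : ∀ P Q →
  lucas P * lucas (suc (suc Q)) + 3ℚ * (lucas (suc P) * lucas (suc Q)) + lucas (suc (suc P)) * lucas Q
    ≡ 5ℚ * lucas (suc (suc (P +ℕ Q)))
lucas-products zero Q = base₀ (lucas (suc Q)) (lucas Q)
  where
  base₀ : ∀ a b → 2ℚ * (a + b) + 3ℚ * (1ℚ * a) + (1ℚ + 2ℚ) * b ≡ 5ℚ * (a + b)
  base₀ = solve-∀ ℚ-ring
lucas-products (suc zero) Q = base₁ (lucas (suc Q)) (lucas Q)
  where
  base₁ : ∀ a b → 1ℚ * (a + b) + 3ℚ * ((1ℚ + 2ℚ) * a) + ((1ℚ + 2ℚ) + 1ℚ) * b ≡ 5ℚ * ((a + b) + a)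
  base₁ = solve-∀ ℚ-ring
lucas-products (suc (suc P)) Q = begin
  (p₁ + p₀) * q₂ + 3ℚ * (((p₁ + p₀) + p₁) * q₁) + (((p₁ + p₀) + p₁) + (p₁ + p₀)) * q₀
    ≡⟨ split p₀ p₁ q₀ q₁ q₂ ⟩
  (p₁ * q₂ + 3ℚ * ((p₁ + p₀) * q₁) + ((p₁ + p₀) + p₁) * q₀) + (p₀ * q₂ + 3ℚ * (p₁ * q₁) + (p₁ + p₀) * q₀)
    ≡⟨ cong₂ _+_ (lucas-products (suc P) Q) (lucas-products P Q) ⟩
  5ℚ * lucas (suc (suc (suc (P +ℕ Q)))) + 5ℚ * lucas (suc (suc (P +ℕ Q)))
    ≡⟨ sym (ℚ.*-distribˡ-+ 5ℚ (lucas (suc (suc (suc (P +ℕ Q))))) (lucas (suc (suc (P +ℕ Q))))) ⟩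
  5ℚ * lucas (suc (suc (suc (suc P) +ℕ Q))) ∎
  where
  open ≡-Reasoning
  p₀ p₁ q₀ q₁ q₂ : ℚ
  p₀ = lucas P
  p₁ = lucas (suc P)
  q₀ = lucas Q
  q₁ = lucas (suc Q)
  q₂ = lucas (suc (suc Q))
  split : ∀ p₀ p₁ q₀ q₁ q₂ →
    (p₁ + p₀) * q₂ + 3ℚ * (((p₁ + p₀) + p₁) * q₁) + (((p₁ + p₀) + p₁) + (p₁ + p₀)) * q₀
      ≡ (p₁ * q₂ + 3ℚ * ((p₁ + p₀) * q₁) + ((p₁ + p₀) + p₁) * q₀) + (p₀ * q₂ + 3ℚ * (p₁ * q₁) + (p₁ + p₀) * q₀)
  split = solve-∀ ℚ-ring

5lucas-nonZero : ∀ m → NonZero (5ℚ * lucas m)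
5lucas-nonZero m = ℚ.pos⇒nonZero (5ℚ * lucas m) {{ℚ.pos*pos⇒pos 5ℚ (lucas m) {{positive (lucas-pos m)}}}}

1/5lucas : ℕ → ℚ
1/5lucas m = (1/ (5ℚ * lucas m)) {{5lucas-nonZero m}}

1/5lucas-nonneg : ∀ m → 0ℚ ≤ℚ 1/5lucas m
1/5lucas-nonneg m = ℚ.<⇒≤ (ℚ.positive⁻¹ (1/5lucas m)
  {{ℚ.1/pos⇒pos (5ℚ * lucas m) {{ℚ.pos*pos⇒pos 5ℚ (lucas m) {{positive (lucas-pos m)}}}}}})

≡5lucas⇒*1/5lucas≡1 : ∀ m {a} → a ≡ 5ℚ * lucas m → a * 1/5lucas m ≡ 1ℚ
≡5lucas⇒*1/5lucas≡1 m refl = ℚ.*-inverseʳ (5ℚ * lucas m) {{5lucas-nonZero m}}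

lucas-weight : ℕ → ℕ → ℚ
lucas-weight M i = 2ℚ * (lucas i * lucas (M ∸ i)) + (lucas (suc M) - 2ℚ * lucas M)

-- For m ≥ 2, representer m solves G w = 1 for the Gram matrix G of gapForm m, whose rows are
-- (2, 1), (1, 3, 1), …, (1, 3, 1), (1, 2): the interior rows reduce to lucas-products, the
-- boundary rows to the Lucas recurrence.
representer : ℕ → ℕ → ℚ
representer zero    i = 0ℚ
representer (suc M) i = lucas-weight M i * 1/5lucas (suc M)

module RepresenterRows (M : ℕ) where
  private
    m : ℕ
    m = suc (suc M)
    n : ℕ → ℚ
    n = lucas-weight (suc M)
    w : ℕ → ℚ
    w = representer m
    K : ℚ
    K = lucas (suc (suc M)) - 2ℚ * lucas (suc M)
    collect : ∀ a b c v → a * v + (b * v + c * v) ≡ (a + (b + c)) * v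
    collect = solve-∀ ℚ-ring

  first : w 0 + (w 0 + w 1) ≡ 1ℚ
  first = trans (collect (n 0) (n 0) (n 1) (1/5lucas m))
    (≡5lucas⇒*1/5lucas≡1 m (rows (lucas (suc M)) (lucas M)))
    where
    rows : ∀ a b → let k = (a + b) - 2ℚ * a in
      (2ℚ * (2ℚ * a) + k) + ((2ℚ * (2ℚ * a) + k) + (2ℚ * (1ℚ * b) + k)) ≡ 5ℚ * (a + b)
    rows = solve-∀ ℚ-ring

  last : w (suc M) + (w M + w (suc M)) ≡ 1ℚ
  last = trans (collect (n (suc M)) (n M) (n (suc M)) (1/5lucas m))
    (≡5lucas⇒*1/5lucas≡1 m (trans
      (cong₂ (λ i j → (2ℚ * (lucas (suc M) * lucas i) + K) + ((2ℚ * (lucas M * lucas j) + K) + (2ℚ * (lucas (suc M) * lucas i) + K)))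
             (ℕ.n∸n≡0 M) (ℕ.m+n∸n≡m 1 M))
      (rows (lucas (suc M)) (lucas M))))
    where
    rows : ∀ a b → let k = (a + b) - 2ℚ * a in
      (2ℚ * (a * 2ℚ) + k) + ((2ℚ * (b * 1ℚ) + k) + (2ℚ * (a * 2ℚ) + k)) ≡ 5ℚ * (a + b)
    rows = solve-∀ ℚ-ring

  inner : ∀ i → i < M → w (suc i) + (w (suc i) + w (suc (suc i))) + (w i + w (suc i)) ≡ 1ℚ
  inner i i<M = trans (collect₄ (n i) (n (suc i)) (n (suc (suc i))) (1/5lucas m))
    (≡5lucas⇒*1/5lucas≡1 m (begin
      n (suc i) + (n (suc i) + n (suc (suc i))) + (n i + n (suc i))
        ≡⟨ cong₂ (λ a b → b + (b + n (suc (suc i))) + (a + b)) n₀ n₁ ⟩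
      (2ℚ * x₁ + K) + ((2ℚ * x₁ + K) + (2ℚ * x₂ + K)) + ((2ℚ * x₀ + K) + (2ℚ * x₁ + K))
        ≡⟨ regroup x₀ x₁ x₂ K ⟩
      2ℚ * (x₀ + 3ℚ * x₁ + x₂) + 5ℚ * K
        ≡⟨ cong (λ t → 2ℚ * t + 5ℚ * K) (trans (lucas-products i Q) (cong (λ j → 5ℚ * lucas (suc j)) (ℕ.m+[n∸m]≡n i<M))) ⟩
      2ℚ * (5ℚ * lucas (suc M)) + 5ℚ * K
        ≡⟨ rows (lucas (suc M)) (lucas M) ⟩
      5ℚ * lucas m ∎))
    where
    open ≡-Reasoning
    Q : ℕ
    Q = M ∸ suc i
    x₀ x₁ x₂ : ℚ
    x₀ = lucas i * lucas (suc (suc Q))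
    x₁ = lucas (suc i) * lucas (suc Q)
    x₂ = lucas (suc (suc i)) * lucas Q
    M∸i≡1+Q : M ∸ i ≡ suc Q
    M∸i≡1+Q = ℕ.+-∸-assoc 1 i<M
    n₀ : n i ≡ 2ℚ * x₀ + K
    n₀ = cong (λ j → 2ℚ * (lucas i * lucas j) + K) (trans (ℕ.+-∸-assoc 1 (ℕ.<⇒≤ i<M)) (cong suc M∸i≡1+Q))
    n₁ : n (suc i) ≡ 2ℚ * x₁ + K
    n₁ = cong (λ j → 2ℚ * (lucas (suc i) * lucas j) + K) M∸i≡1+Q
    collect₄ : ∀ a b c v → b * v + (b * v + c * v) + (a * v + b * v) ≡ (b + (b + c) + (a + b)) * v
    collect₄ = solve-∀ ℚ-ring
    regroup : ∀ x₀ x₁ x₂ k → (2ℚ * x₁ + k) + ((2ℚ * x₁ + k) + (2ℚ * x₂ + k)) + ((2ℚ * x₀ + k) + (2ℚ * x₁ + k))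
                             ≡ 2ℚ * (x₀ + 3ℚ * x₁ + x₂) + 5ℚ * k
    regroup = solve-∀ ℚ-ring
    rows : ∀ a b → 2ℚ * (5ℚ * a) + 5ℚ * ((a + b) - 2ℚ * a) ≡ 5ℚ * (a + b)
    rows = solve-∀ ℚ-ring

representer-represents-sum : ∀ M u → gapForm (suc (suc M)) u (representer (suc (suc M))) ≡ sumℕ (suc (suc M)) u
representer-represents-sum M = rows≡1⇒represents-sum M (representer (suc (suc M))) first inner last
  where open RepresenterRows M

endToEnd : ℕ → ℚ
endToEnd m = sumℕ m (representer m)

representer-energy : ∀ M → gapForm (suc (suc M)) (representer (suc (suc M))) (representer (suc (suc M))) ≡ endToEnd (suc (suc M))
representer-energy M = representer-represents-sum M (representer (suc (suc M)))

dirichlet-principle : ∀ M (y : ℕ → ℚ) → let m = suc (suc M) in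
  (sumℕ m y + sumℕ m y) - gapForm m y y ≤ℚ endToEnd m
dirichlet-principle M y = begin
  (sumℕ m y + sumℕ m y) - gapForm m y y   ≡⟨ cong (λ t → (t + t) - gapForm m y y) (sym (representer-represents-sum M y)) ⟩
  (gapForm m y w + gapForm m y w) - gapForm m y y ≤⟨ gapForm-cross-≤ m y w ⟩
  gapForm m w w                           ≡⟨ representer-energy M ⟩
  endToEnd m                              ∎
  where
  open ℚ.≤-Reasoning
  m : ℕ
  m = suc (suc M)
  w : ℕ → ℚ
  w = representer m

representer-nonneg₀ : ∀ M → 0ℚ ≤ℚ representer (suc (suc M)) 0
representer-nonneg₀ M = nonneg*nonneg weight≥0 (1/5lucas-nonneg (suc (suc M)))
  where
  weight≥0 : 0ℚ ≤ℚ lucas-weight (suc M) 0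
  weight≥0 = ℚ.≤-trans (ℚ.+-mono-≤ a≥0 (ℚ.+-mono-≤ a≥0 (ℚ.+-mono-≤ a≥0 (lucas-nonneg M))))
                       (ℚ.≤-reflexive (rearrange (lucas (suc M)) (lucas M)))
    where
    a≥0 : 0ℚ ≤ℚ lucas (suc M)
    a≥0 = lucas-nonneg (suc M)
    rearrange : ∀ a b → a + (a + (a + b)) ≡ 2ℚ * (2ℚ * a) + ((a + b) - 2ℚ * a)
    rearrange = solve-∀ ℚ-ring

representer-nonneg₁ : ∀ M → 0ℚ ≤ℚ representer (suc (suc M)) 1
representer-nonneg₁ M = nonneg*nonneg weight≥0 (1/5lucas-nonneg (suc (suc M)))
  where
  weight≥0 : 0ℚ ≤ℚ lucas-weight (suc M) 1
  weight≥0 = ℚ.≤-trans (≤⇒0≤- (lucas-suc≤3*lucas M)) (ℚ.≤-reflexive (rearrange (lucas (suc M)) (lucas M)))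
    where
    rearrange : ∀ a b → 3ℚ * b - a ≡ 2ℚ * (1ℚ * b) + ((a + b) - 2ℚ * a)
    rearrange = solve-∀ ℚ-ring

insert-zero-at-1 : (ℕ → ℚ) → ℕ → ℚ
insert-zero-at-1 w zero          = w 0
insert-zero-at-1 w (suc zero)    = 0ℚ
insert-zero-at-1 w (suc (suc i)) = w (suc i)

-- Inserting a zero between the first two entries of the representer keeps its sum and lowers its
-- energy by 2 w₀ w₁ ≥ 0; the Dirichlet principle for the longer window then gives the bound.
endToEnd-step : ∀ {m} → 2 ≤ m → endToEnd m ≤ℚ endToEnd (suc m)
endToEnd-step {suc (suc M)} (s≤s (s≤s _)) = begin
  endToEnd m                                         ≡⟨ pad (endToEnd m) ⟩
  endToEnd m + (0ℚ + 0ℚ)                             ≤⟨ ℚ.+-monoʳ-≤ (endToEnd m) (ℚ.+-mono-≤ w₀w₁≥0 w₀w₁≥0) ⟩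
  endToEnd m + (w 0 * w 1 + w 0 * w 1)               ≡⟨ reassemble (endToEnd m) (w 0 * w 1) ⟩
  (endToEnd m + endToEnd m) - (endToEnd m - 2ℚ * (w 0 * w 1)) ≡⟨ cong₂ (λ s q → (s + s) - q) (sym sum-y) (sym energy-y) ⟩
  (sumℕ (suc m) y + sumℕ (suc m) y) - gapForm (suc m) y y ≤⟨ dirichlet-principle (suc M) y ⟩
  endToEnd (suc m)                                   ∎
  where
  open ℚ.≤-Reasoning
  m : ℕ
  m = suc (suc M)
  w y : ℕ → ℚ
  w = representer m
  y = insert-zero-at-1 w
  w₀w₁≥0 : 0ℚ ≤ℚ w 0 * w 1
  w₀w₁≥0 = nonneg*nonneg (representer-nonneg₀ M) (representer-nonneg₁ M)
  sum-y : sumℕ (suc m) y ≡ endToEnd m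
  sum-y = cong (w 0 +_) (ℚ.+-identityˡ _)
  energy-y : gapForm (suc m) y y ≡ endToEnd m - 2ℚ * (w 0 * w 1)
  energy-y = trans (drop-zero (w 0) (w 1) (sumℕ (suc M) (λ i → w (suc i) * w (suc i)))
                              (sumℕ M (λ i → (w (suc i) + w (suc (suc i))) * (w (suc i) + w (suc (suc i))))))
                   (cong (_- 2ℚ * (w 0 * w 1)) (representer-energy M))
    where
    drop-zero : ∀ a b p q → (a * a + (0ℚ * 0ℚ + p)) + ((a + 0ℚ) * (a + 0ℚ) + ((0ℚ + b) * (0ℚ + b) + q))
                            ≡ ((a * a + p) + ((a + b) * (a + b) + q)) - 2ℚ * (a * b)
    drop-zero = solve-∀ ℚ-ring
  pad : ∀ s → s ≡ s + (0ℚ + 0ℚ)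
  pad = solve-∀ ℚ-ring
  reassemble : ∀ s p → s + (p + p) ≡ (s + s) - (s - 2ℚ * p)
  reassemble = solve-∀ ℚ-ring

endToEnd-mono : ∀ {m} k → 2 ≤ m → m ≤ k → endToEnd m ≤ℚ endToEnd k
endToEnd-mono zero    (s≤s _) ()
endToEnd-mono (suc k) 2≤m m≤1+k with ℕ.m≤n⇒m<n∨m≡n m≤1+k
... | inj₂ refl       = ℚ.≤-refl
... | inj₁ (s≤s m≤k) = ℚ.≤-trans (endToEnd-mono k 2≤m m≤k) (endToEnd-step (ℕ.≤-trans 2≤m m≤k))

window-dual-bound : ∀ s m {k} (y w : ℕ → ℚ) {r} → s +ℕ m ≤ k →
  gapForm k y y ≡ r → gapForm m (λ i → y (s +ℕ i)) w ≡ r → r ≤ℚ gapForm m w w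
window-dual-bound s m y w s+m≤k Qyy≡r =
  gapForm-dual-bound m (λ i → y (s +ℕ i)) w (ℚ.≤-trans (gapForm-window-≤ s m y s+m≤k) (ℚ.≤-reflexive Qyy≡r))

-- The columns of the inverse of the Gram matrix (2 1; 1 2) of gapForm 2.
coordinate-representer₀ coordinate-representer₁ : ℕ → ℚ
coordinate-representer₀ zero          = normalize 2 3
coordinate-representer₀ (suc zero)    = - normalize 1 3
coordinate-representer₀ (suc (suc _)) = 0ℚ
coordinate-representer₁ zero          = - normalize 1 3
coordinate-representer₁ (suc zero)    = normalize 2 3
coordinate-representer₁ (suc (suc _)) = 0ℚ

coordinate-representer₀-represents : ∀ u → gapForm 2 u coordinate-representer₀ ≡ u 0
coordinate-representer₀-represents u = represents (u 0) (u 1)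
  where
  represents : ∀ a b → (a * normalize 2 3 + (b * - normalize 1 3 + 0ℚ)) + ((a + b) * (normalize 2 3 + - normalize 1 3) + 0ℚ) ≡ a
  represents = solve-∀ ℚ-ring

coordinate-representer₁-represents : ∀ u → gapForm 2 u coordinate-representer₁ ≡ u 1
coordinate-representer₁-represents u = represents (u 0) (u 1)
  where
  represents : ∀ a b → (a * - normalize 1 3 + (b * normalize 2 3 + 0ℚ)) + ((a + b) * (- normalize 1 3 + normalize 2 3) + 0ℚ) ≡ b
  represents = solve-∀ ℚ-ring

-- A window of length 1 would only give r ≤ 1; a window of length 2 around the gap gives r ≤ 2/3.
single-gap-bound : ∀ s {k} (y : ℕ → ℚ) {r} → 2 ≤ k → s < k → gapForm k y y ≡ r → y s ≡ r → r ≤ℚ endToEnd 2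
single-gap-bound zero    y 2≤k _   Qyy≡r y₀≡r =
  window-dual-bound 0 2 y coordinate-representer₀ 2≤k Qyy≡r (trans (coordinate-representer₀-represents y) y₀≡r)
single-gap-bound (suc s) {k} y _   s<k Qyy≡r yₛ≡r =
  window-dual-bound s 2 y coordinate-representer₁ (subst (_≤ k) (ℕ.+-comm 2 s) s<k) Qyy≡r
    (trans (coordinate-representer₁-represents (λ i → y (s +ℕ i))) (trans (cong y (ℕ.+-comm s 1)) yₛ≡r))

window-sum-bound : ∀ s m {k} (y : ℕ → ℚ) {r} → 2 ≤ k → 1 ≤ m → s +ℕ m ≤ k →
  gapForm k y y ≡ r → sumℕ m (λ i → y (s +ℕ i)) ≡ r → r ≤ℚ endToEnd k
window-sum-bound s 1 {k} y 2≤k _ s+1≤k Qyy≡r sum≡r = ℚ.≤-trans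
  (single-gap-bound s y 2≤k (subst (_≤ k) (ℕ.+-comm s 1) s+1≤k) Qyy≡r
    (trans (sym (trans (ℚ.+-identityʳ _) (cong y (ℕ.+-identityʳ s)))) sum≡r))
  (endToEnd-mono k ℕ.≤-refl 2≤k)
window-sum-bound s (suc (suc M)) {k} y _ _ s+m≤k Qyy≡r sum≡r = ℚ.≤-trans
  (window-dual-bound s (suc (suc M)) y (representer (suc (suc M))) s+m≤k Qyy≡r
    (trans (representer-represents-sum M (λ i → y (s +ℕ i))) sum≡r))
  (ℚ.≤-trans (ℚ.≤-reflexive (representer-energy M)) (endToEnd-mono k (s≤s (s≤s z≤n)) (ℕ.≤-trans (ℕ.m≤n+m _ s) s+m≤k)))

module StraightLinear2Tree (k : ℕ) (X : Matrix (suc k)) (mp : IsMoorePenroseInverse (laplacian (suc k)) X) where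
  open MoorePenrose k X mp

  gaps : Fin (suc k) → Fin (suc k) → ℕ → ℚ
  gaps a b = Δ (extend (Potential.v a b))

  gaps-energy : ∀ a b → gapForm k (gaps a b) (gaps a b) ≡ resistance X a b
  gaps-energy a b = trans (energy v) (sym resistance≡drop)
    where open Potential a b

  gaps-window-sum : ∀ a b → toℕ a ≤ toℕ b → sumℕ (toℕ b ∸ toℕ a) (λ i → gaps a b (toℕ a +ℕ i)) ≡ resistance X a b
  gaps-window-sum a b a≤b = begin
    sumℕ (toℕ b ∸ toℕ a) (λ i → Δ (extend v) (toℕ a +ℕ i)) ≡⟨ sumℕ-telescope-from (extend v) a≤b ⟩
    extend v (toℕ a) - extend v (toℕ b)                  ≡⟨ cong₂ _-_ (extend-toℕ v a) (extend-toℕ v b) ⟩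
    v a - v b                                            ≡⟨ sym resistance≡drop ⟩
    resistance X a b                                     ∎
    where
    open ≡-Reasoning
    open Potential a b

  -- Test the energy identity of the end-to-end potential against minus the prefix sums of u,
  -- whose gaps are u.
  end-gaps-represent-sum : ∀ u → gapForm k u (gaps zero (fromℕ k)) ≡ sumℕ k u
  end-gaps-represent-sum u = begin
    gapForm k u (gaps zero (fromℕ k))                      ≡⟨ gapForm-congˡ< k (gaps zero (fromℕ k)) (λ i i<k → sym (Δz≡u i<k)) ⟩
    gapForm k (Δ (extend z)) (Δ (extend v))                 ≡⟨ energy z ⟩
    Z (toℕ {suc k} zero) - Z (toℕ (fromℕ k))                ≡⟨ cong (λ j → Z 0 - Z j) (toℕ-fromℕ k) ⟩
    - 0ℚ - - sumℕ k u                                      ≡⟨ cancel (sumℕ k u) ⟩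
    sumℕ k u                                               ∎
    where
    open ≡-Reasoning
    open Potential zero (fromℕ k)
    Z : ℕ → ℚ
    Z j = - sumℕ j u
    z : Fin (suc k) → ℚ
    z i = Z (toℕ i)
    cancel : ∀ s → - 0ℚ - - s ≡ s
    cancel = solve-∀ ℚ-ring
    step : ∀ s x → - s - - (s + x) ≡ x
    step = solve-∀ ℚ-ring
    Δz≡u : ∀ {i} → i < k → Δ (extend z) i ≡ u i
    Δz≡u {i} i<k = begin
      extend z i - extend z (suc i) ≡⟨ cong₂ _-_ (extend-tabulate (suc k) Z (ℕ.m<n⇒m<1+n i<k)) (extend-tabulate (suc k) Z (s≤s i<k)) ⟩
      - sumℕ i u - - sumℕ (suc i) u ≡⟨ cong (λ t → - sumℕ i u - - t) (sumℕ-last i u) ⟩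
      - sumℕ i u - - (sumℕ i u + u i) ≡⟨ step (sumℕ i u) (u i) ⟩
      u i                             ∎

  ends-resistance≡endToEnd : 2 ≤ k → resistance X zero (fromℕ k) ≡ endToEnd k
  ends-resistance≡endToEnd (s≤s (s≤s {n = M} _)) = begin
    resistance X zero (fromℕ k) ≡⟨ sym (gaps-energy zero (fromℕ k)) ⟩
    gapForm k y y               ≡⟨ end-gaps-represent-sum y ⟩
    sumℕ k y                    ≡⟨ sym (representer-represents-sum M y) ⟩
    gapForm k y w               ≡⟨ gapForm-sym k y w ⟩
    gapForm k w y               ≡⟨ end-gaps-represent-sum w ⟩
    endToEnd k                  ∎
    where
    open ≡-Reasoning
    y w : ℕ → ℚ
    y = gaps zero (fromℕ k)
    w = representer k

  ordered-resistance≤ends : 2 ≤ k → ∀ a b → toℕ a < toℕ b → resistance X a b ≤ℚ resistance X zero (fromℕ k)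
  ordered-resistance≤ends 2≤k a b a<b = ℚ.≤-trans
    (window-sum-bound (toℕ a) (toℕ b ∸ toℕ a) (gaps a b) 2≤k (ℕ.m<n⇒0<n∸m a<b) window⊆path
      (gaps-energy a b) (gaps-window-sum a b (ℕ.<⇒≤ a<b)))
    (ℚ.≤-reflexive (sym (ends-resistance≡endToEnd 2≤k)))
    where
    window⊆path : toℕ a +ℕ (toℕ b ∸ toℕ a) ≤ k
    window⊆path = subst (_≤ k) (sym (ℕ.m+[n∸m]≡n (ℕ.<⇒≤ a<b))) (toℕ≤pred[n] b)

  resistance-self≡0 : ∀ a → resistance X a a ≡ 0ℚ
  resistance-self≡0 a = trans resistance≡drop (ℚ.+-inverseʳ (v a))
    where open Potential a a

  ends-resistance-nonneg : 0ℚ ≤ℚ resistance X zero (fromℕ k)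
  ends-resistance-nonneg = ℚ.≤-trans (gapForm-nonneg k (gaps zero (fromℕ k))) (ℚ.≤-reflexive (gaps-energy zero (fromℕ k)))

corollary6p2 : (k : ℕ) → 2 ≤ k → (X : Matrix (suc k)) →
    IsMoorePenroseInverse (laplacian (suc k)) X →
    (a b : Fin (suc k)) → resistance X a b ≤ℚ resistance X zero (fromℕ k)
corollary6p2 k 2≤k X mp a b = by-order (ℕ.<-cmp (toℕ a) (toℕ b))
  where
  open StraightLinear2Tree k X mp
  open ℚ.≤-Reasoning
  by-order : Tri (toℕ a < toℕ b) (toℕ a ≡ toℕ b) (toℕ a > toℕ b) → resistance X a b ≤ℚ resistance X zero (fromℕ k)
  by-order (tri< a<b _ _) = ordered-resistance≤ends 2≤k a b a<b
  by-order (tri> _ _ b<a) = begin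
    resistance X a b            ≡⟨ resistance-sym X a b ⟩
    resistance X b a            ≤⟨ ordered-resistance≤ends 2≤k b a b<a ⟩
    resistance X zero (fromℕ k) ∎
  by-order (tri≈ _ a≡b _) = begin
    resistance X a b            ≡⟨ cong (resistance X a) (sym (toℕ-injective a≡b)) ⟩
    resistance X a a            ≡⟨ resistance-self≡0 a ⟩
    0ℚ                          ≤⟨ ends-resistance-nonneg ⟩
    resistance X zero (fromℕ k) ∎
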